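{- Let $\mathcal{K}=(K,\leq,\Vdash)$ be a finite-depth Kripke model for the propositional language $\mathcal{L}_0$. Then for every $\alpha\in K$ there exists $\rho\in{\sf PEM}(\mathcal{L}_0)^*$ such that for every propositional formula $A$, $$\alpha\Vdash A^{\rho}\quad\text{iff}\quad\alpha\models A.$$
   Context: $\mathcal{L}_0$ is the propositional language with connectives $\vee,\wedge,\to,\bot$ and propositional variables; $\neg A$ abbreviates $A\to\bot$. A propositional Kripke model is $(K,\leq,\Vdash)$ with $(K,\leq)$ a nonempty poset and $\Vdash$ a relation between nodes and propositional variables that is monotone along $\leq$, extended to all formulas in the standard intuitionistic way ($\bot$ never forced, $\alpha\Vdash A\to B$ iff every $\beta\geq\alpha$ forcing $A$ forces $B$). $\alpha\models A$ means that $A$ is true in the classical valuation at $\alpha$ which makes a variable true iff it is forced at $\alpha$. The depth of the model is the maximum $n$ such that no chain in $(K,\leq)$ is longer than $n$; finite depth means such $n$ exists. For a formula $\rho$, the Friedman translation $A^\rho$ replaces each atomic subformula $P$ (including $\bot$) by $P\vee\rho$ and commutes with $\wedge,\vee,\to$. ${\sf PEM}(\mathcal{L}_0)$ is the set of all formulas $A\vee\neg A$ with $A\in\mathcal{L}_0$. For a set $\Gamma$ of formulas, $\Gamma^*=\bigcup_n\Gamma^n$ where $\Gamma^0=\{\bot\}$ and $\Gamma^{n+1}=\{A^B:A\in\Gamma^n,\ B\in\Gamma\}$. -}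

module Defs where

open import Data.Nat using (ℕ; zero; suc; _≤_)
open import Data.List using (List; []; _∷_; length)
open import Data.Product using (Σ; ∃; _×_; _,_)
open import Data.Sum using (_⊎_)
open import Data.Empty using (⊥)
open import Relation.Nullary using (¬_)
open import Relation.Binary.PropositionalEquality using (_≡_)

infixr 6 _∧'_
infixr 5 _∨'_
infixr 4 _⇒_

data Formula : Set where
  var  : ℕ → Formula
  ⊥'   : Formula
  _∧'_ : Formula → Formula → Formula
  _∨'_ : Formula → Formula → Formula
  _⇒_  : Formula → Formula → Formula

¬' : Formula → Formula
¬' A = A ⇒ ⊥'

_^_ : Formula → Formula → Formula
var p ^ ρ = var p ∨' ρ
⊥' ^ ρ = ⊥' ∨' ρ
(A ∧' B) ^ ρ = (A ^ ρ) ∧' (B ^ ρ)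
(A ∨' B) ^ ρ = (A ^ ρ) ∨' (B ^ ρ)
(A ⇒ B) ^ ρ = (A ^ ρ) ⇒ (B ^ ρ)

PEM : Formula → Set
PEM ρ = Σ Formula λ A → ρ ≡ (A ∨' ¬' A)

PEMPow : ℕ → Formula → Set
PEMPow zero ρ = ρ ≡ ⊥'
PEMPow (suc n) ρ = Σ Formula λ A → Σ Formula λ B → PEMPow n A × PEM B × (ρ ≡ (A ^ B))

PEMStar : Formula → Set
PEMStar ρ = ∃ λ n → PEMPow n ρ

record KripkeModel : Set₁ where
  field
    K        : Set
    _≤K_     : K → K → Set
    inhabited : K
    ≤-refl   : ∀ {a} → a ≤K a
    ≤-trans  : ∀ {a b c} → a ≤K b → b ≤K c → a ≤K c
    ≤-antisym : ∀ {a b} → a ≤K b → b ≤K a → a ≡ b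
    Vforce   : K → ℕ → Set
    mono     : ∀ {a b p} → a ≤K b → Vforce a p → Vforce b p

module _ (M : KripkeModel) where
  open KripkeModel M

  _⊩_ : K → Formula → Set
  a ⊩ var p = Vforce a p
  a ⊩ ⊥' = ⊥
  a ⊩ (A ∧' B) = (a ⊩ A) × (a ⊩ B)
  a ⊩ (A ∨' B) = (a ⊩ A) ⊎ (a ⊩ B)
  a ⊩ (A ⇒ B) = ∀ b → a ≤K b → b ⊩ A → b ⊩ B

  -- classical truth at a node: the classical valuation making a variable
  -- true iff it is forced at that node
  _⊨_ : K → Formula → Set
  a ⊨ var p = Vforce a p
  a ⊨ ⊥' = ⊥
  a ⊨ (A ∧' B) = (a ⊨ A) × (a ⊨ B)
  a ⊨ (A ∨' B) = (a ⊨ A) ⊎ (a ⊨ B)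
  a ⊨ (A ⇒ B) = a ⊨ A → a ⊨ B

  _<K_ : K → K → Set
  a <K b = (a ≤K b) × ¬ (a ≡ b)

  data Chain : List K → Set where
    []  : Chain []
    [_] : ∀ a → Chain (a ∷ [])
    step : ∀ {a b xs} → a <K b → Chain (b ∷ xs) → Chain (a ∷ b ∷ xs)

  FiniteDepth : Set
  FiniteDepth = ∃ λ n → ∀ (xs : List K) → Chain xs → length xs ≤ n

-- Call τ isolating at α when α does not force τ and every β ≥ α not forcing τ forces exactly the
-- variables that α forces. For such β, induction on A gives β ⊩ A^τ iff α ⊨ A: at an
-- implication, the successors of β that force τ force every B^τ, and the remaining ones look
-- classically like α. An isolating formula ρ^⊥ with ρ ∈ PEM* is found by induction on the depth of
-- the region above α of nodes not forcing the current σ (initially ⊥). If some node of that region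
-- forces a variable p that α does not, then α still does not force σ′ = (p ∨ ¬p)^σ, while every node
-- not forcing σ′ has a strict successor not forcing σ, so the region of σ′ is shallower. Since
-- (ρ^(p ∨ ¬p))^σ and ρ^((p ∨ ¬p)^σ) are forced at the same nodes, the recursion stays inside PEM*.
module Submission where

open import Defs
open import Data.Product using (Σ; ∃; _×_; _,_)
open import Data.Product.Function.NonDependent.Propositional using (_×-⇔_)
open import Data.Sum using (inj₁; inj₂)
open import Data.Sum.Function.Propositional using (_⊎-⇔_)
open import Data.Empty using (⊥; ⊥-elim)
open import Data.Nat using (ℕ; zero; suc; _≤_; s≤s⁻¹)
open import Data.List using ([]; _∷_; length)
open import Relation.Nullary using (¬_; yes; no)
open import Relation.Binary.PropositionalEquality using (refl)
open import Function using (_∘_)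
open import Function.Bundles using (_⇔_; mk⇔; Equivalence)
open import Function.Construct.Symmetry using (⇔-sym)
open import Axiom.ExcludedMiddle using (ExcludedMiddle)
open import Level using (0ℓ)

open Equivalence using (to; from)

PEMStar-^ : ∀ {A B} → PEMStar A → PEM B → PEMStar (A ^ B)
PEMStar-^ {A} {B} (n , A∈Γⁿ) B∈Γ = suc n , A , B , A∈Γⁿ , B∈Γ , refl

PEMᵥ : ℕ → Formula
PEMᵥ p = var p ∨' ¬' (var p)

module Forcing (M : KripkeModel) where
  open KripkeModel M

  infix 3.5 _⊩ᴹ_
  infix 3 _≋_

  _⊩ᴹ_ : K → Formula → Set
  _⊩ᴹ_ = _⊩_ M

  record _≋_ (A B : Formula) : Set where
    constructor mk≋
    field at : ∀ γ → γ ⊩ᴹ A ⇔ γ ⊩ᴹ B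

  open _≋_ public

  ⊩-mono : ∀ A {β γ} → β ≤K γ → β ⊩ᴹ A → γ ⊩ᴹ A
  ⊩-mono (var p)  β≤γ v        = mono β≤γ v
  ⊩-mono (A ∧' B) β≤γ (a , b)  = ⊩-mono A β≤γ a , ⊩-mono B β≤γ b
  ⊩-mono (A ∨' B) β≤γ (inj₁ a) = inj₁ (⊩-mono A β≤γ a)
  ⊩-mono (A ∨' B) β≤γ (inj₂ b) = inj₂ (⊩-mono B β≤γ b)
  ⊩-mono (A ⇒ B)  β≤γ f δ γ≤δ  = f δ (≤-trans β≤γ γ≤δ)

  ⊩-^ʳ : ∀ σ A {γ} → γ ⊩ᴹ σ → γ ⊩ᴹ A ^ σ
  ⊩-^ʳ σ (var p)  s         = inj₂ s
  ⊩-^ʳ σ ⊥'       s         = inj₂ s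
  ⊩-^ʳ σ (A ∧' B) s         = ⊩-^ʳ σ A s , ⊩-^ʳ σ B s
  ⊩-^ʳ σ (A ∨' B) s         = inj₁ (⊩-^ʳ σ A s)
  ⊩-^ʳ σ (A ⇒ B)  s δ γ≤δ _ = ⊩-^ʳ σ B (⊩-mono σ γ≤δ s)

  ≋-sym : ∀ {A B} → A ≋ B → B ≋ A
  ≋-sym A≋B = mk≋ (⇔-sym ∘ at A≋B)

  ∧-cong : ∀ {A A′ B B′} → A ≋ A′ → B ≋ B′ → A ∧' B ≋ A′ ∧' B′
  ∧-cong A≋A′ B≋B′ = mk≋ λ γ → at A≋A′ γ ×-⇔ at B≋B′ γ

  ∨-cong : ∀ {A A′ B B′} → A ≋ A′ → B ≋ B′ → A ∨' B ≋ A′ ∨' B′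
  ∨-cong A≋A′ B≋B′ = mk≋ λ γ → at A≋A′ γ ⊎-⇔ at B≋B′ γ

  ⇒-cong : ∀ {A A′ B B′} → A ≋ A′ → B ≋ B′ → A ⇒ B ≋ A′ ⇒ B′
  ⇒-cong A≋A′ B≋B′ = mk≋ λ _ → mk⇔
    (λ f δ γ≤δ a′ → to (at B≋B′ δ) (f δ γ≤δ (from (at A≋A′ δ) a′)))
    (λ f δ γ≤δ a → from (at B≋B′ δ) (f δ γ≤δ (to (at A≋A′ δ) a)))

  ^⊥≋ : ∀ A → A ^ ⊥' ≋ A
  ^⊥≋ (var p)  = mk≋ λ _ → mk⇔ (λ { (inj₁ v) → v ; (inj₂ ()) }) inj₁
  ^⊥≋ ⊥'       = mk≋ λ _ → mk⇔ (λ { (inj₁ ()) ; (inj₂ ()) }) λ ()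
  ^⊥≋ (A ∧' B) = ∧-cong (^⊥≋ A) (^⊥≋ B)
  ^⊥≋ (A ∨' B) = ∨-cong (^⊥≋ A) (^⊥≋ B)
  ^⊥≋ (A ⇒ B)  = ⇒-cong (^⊥≋ A) (^⊥≋ B)

  ∨-^-absorb : ∀ P B σ → (P ∨' σ) ∨' B ^ σ ≋ P ∨' B ^ σ
  ∨-^-absorb P B σ = mk≋ λ _ → mk⇔
    (λ { (inj₁ (inj₁ x)) → inj₁ x ; (inj₁ (inj₂ s)) → inj₂ (⊩-^ʳ σ B s) ; (inj₂ b) → inj₂ b })
    (λ { (inj₁ x) → inj₁ (inj₁ x) ; (inj₂ b) → inj₂ b })

  ^-assoc : ∀ B σ A → (A ^ B) ^ σ ≋ A ^ (B ^ σ)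
  ^-assoc B σ (var p)  = ∨-^-absorb (var p) B σ
  ^-assoc B σ ⊥'       = ∨-^-absorb ⊥' B σ
  ^-assoc B σ (A ∧' C) = ∧-cong (^-assoc B σ A) (^-assoc B σ C)
  ^-assoc B σ (A ∨' C) = ∨-cong (^-assoc B σ A) (^-assoc B σ C)
  ^-assoc B σ (A ⇒ C)  = ⇒-cong (^-assoc B σ A) (^-assoc B σ C)

module Classical (em : ExcludedMiddle 0ℓ) (M : KripkeModel) where
  open KripkeModel M
  open Forcing M

  infix 3.5 _⊨ᴹ_
  infix 4 _<ᴹ_

  _⊨ᴹ_ : K → Formula → Set
  _⊨ᴹ_ = _⊨_ M

  _<ᴹ_ : K → K → Set
  _<ᴹ_ = _<K_ M

  record Isolates (α : K) (τ : Formula) : Set where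
    field
      unforced : ¬ α ⊩ᴹ τ
      agrees   : ∀ {β p} → α ≤K β → ¬ β ⊩ᴹ τ → Vforce β p → Vforce α p

  open Isolates

  Isolates-resp-≋ : ∀ {α τ τ′} → τ ≋ τ′ → Isolates α τ → Isolates α τ′
  Isolates-resp-≋ τ≋τ′ iso = record
    { unforced = unforced iso ∘ from (at τ≋τ′ _)
    ; agrees   = λ α≤β β⊮τ′ → agrees iso α≤β (β⊮τ′ ∘ to (at τ≋τ′ _))
    }

  ⊩^⇔⊨ : ∀ {α τ} → Isolates α τ → ∀ A {β} → α ≤K β → ¬ β ⊩ᴹ τ → β ⊩ᴹ A ^ τ ⇔ α ⊨ᴹ A
  ⊩^⇔⊨ iso (var p) α≤β β⊮τ = mk⇔
    (λ { (inj₁ v) → agrees iso α≤β β⊮τ v ; (inj₂ t) → ⊥-elim (β⊮τ t) })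
    (inj₁ ∘ mono α≤β)
  ⊩^⇔⊨ iso ⊥' α≤β β⊮τ = mk⇔ (λ { (inj₁ ()) ; (inj₂ t) → β⊮τ t }) λ ()
  ⊩^⇔⊨ iso (A ∧' B) α≤β β⊮τ = ⊩^⇔⊨ iso A α≤β β⊮τ ×-⇔ ⊩^⇔⊨ iso B α≤β β⊮τ
  ⊩^⇔⊨ iso (A ∨' B) α≤β β⊮τ = ⊩^⇔⊨ iso A α≤β β⊮τ ⊎-⇔ ⊩^⇔⊨ iso B α≤β β⊮τ
  ⊩^⇔⊨ {α} {τ} iso (A ⇒ B) {β} α≤β β⊮τ = mk⇔
    (λ f a → to (⊩^⇔⊨ iso B α≤β β⊮τ) (f β ≤-refl (from (⊩^⇔⊨ iso A α≤β β⊮τ) a)))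
    classical⇒forced
    where
    classical⇒forced : (α ⊨ᴹ A → α ⊨ᴹ B) → β ⊩ᴹ (A ⇒ B) ^ τ
    classical⇒forced h γ β≤γ a with em {γ ⊩ᴹ τ}
    ... | yes γ⊩τ = ⊩-^ʳ τ B γ⊩τ
    ... | no γ⊮τ  = from (⊩^⇔⊨ iso B α≤γ γ⊮τ) (h (to (⊩^⇔⊨ iso A α≤γ γ⊮τ) a))
      where
      α≤γ : α ≤K γ
      α≤γ = ≤-trans α≤β β≤γ

  -- Every strictly ascending chain from β whose nodes above β do not force σ has at most n nodes.
  Height≤ : Formula → ℕ → K → Set
  Height≤ σ zero    β = ⊥
  Height≤ σ (suc n) β = ∀ {γ} → β <ᴹ γ → ¬ γ ⊩ᴹ σ → Height≤ σ n γ

  depth≤⇒Height≤-⊥ : ∀ n β → (∀ xs → Chain M (β ∷ xs) → length (β ∷ xs) ≤ n) → Height≤ ⊥' n β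
  depth≤⇒Height≤-⊥ zero    β chains≤ with chains≤ [] [ β ]
  ... | ()
  depth≤⇒Height≤-⊥ (suc n) β chains≤ {γ} β<γ _ =
    depth≤⇒Height≤-⊥ n γ λ xs chain → s≤s⁻¹ (chains≤ (γ ∷ xs) (step β<γ chain))

  ⊮PEMᵥ^⇒ascent : ∀ σ p {β} → ¬ β ⊩ᴹ PEMᵥ p ^ σ → ∃ λ γ → β <ᴹ γ × ¬ γ ⊩ᴹ σ
  ⊮PEMᵥ^⇒ascent σ p {β} β⊮ with em {∃ λ γ → β ≤K γ × Vforce γ p × ¬ γ ⊩ᴹ σ}
  ... | yes (γ , β≤γ , γ⊩p , γ⊮σ) = γ , (β≤γ , λ { refl → β⊮ (inj₁ (inj₁ γ⊩p)) }) , γ⊮σ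
  ... | no none = ⊥-elim (β⊮ (inj₂ ¬p^σ))
    where
    ¬p^σ : β ⊩ᴹ ¬' (var p) ^ σ
    ¬p^σ γ β≤γ (inj₂ γ⊩σ) = inj₂ γ⊩σ
    ¬p^σ γ β≤γ (inj₁ γ⊩p) with em {γ ⊩ᴹ σ}
    ... | yes γ⊩σ = inj₂ γ⊩σ
    ... | no γ⊮σ  = ⊥-elim (none (γ , β≤γ , γ⊩p , γ⊮σ))

  Height≤-PEMᵥ^ : ∀ σ p n {β} → ¬ β ⊩ᴹ PEMᵥ p ^ σ → Height≤ σ (suc n) β → Height≤ (PEMᵥ p ^ σ) n β
  Height≤-PEMᵥ^ σ p zero β⊮ height with ⊮PEMᵥ^⇒ascent σ p β⊮
  ... | γ , β<γ , γ⊮σ = height β<γ γ⊮σ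
  Height≤-PEMᵥ^ σ p (suc n) β⊮ height β<γ γ⊮ =
    Height≤-PEMᵥ^ σ p n γ⊮ (height β<γ (γ⊮ ∘ ⊩-^ʳ σ (PEMᵥ p)))

  Disagreement : Formula → K → Set
  Disagreement σ α = ∃ λ β → ∃ λ p → α ≤K β × ¬ β ⊩ᴹ σ × Vforce β p × ¬ Vforce α p

  ¬Disagreement⇒Isolates : ∀ σ {α} → ¬ α ⊩ᴹ σ → ¬ Disagreement σ α → Isolates α (⊥' ^ σ)
  ¬Disagreement⇒Isolates σ {α} α⊮σ agreement = record
    { unforced = λ { (inj₁ ()) ; (inj₂ s) → α⊮σ s }
    ; agrees   = agrees′
    }
    where
    agrees′ : ∀ {β p} → α ≤K β → ¬ β ⊩ᴹ ⊥' ^ σ → Vforce β p → Vforce α p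
    agrees′ {β} {p} α≤β β⊮ β⊩p with em {Vforce α p}
    ... | yes α⊩p = α⊩p
    ... | no α⊮p  = ⊥-elim (agreement (β , p , α≤β , β⊮ ∘ inj₂ , β⊩p , α⊮p))

  Disagreement⇒⊮PEMᵥ^ : ∀ σ {α} → ¬ α ⊩ᴹ σ → ((_ , p , _) : Disagreement σ α) → ¬ α ⊩ᴹ PEMᵥ p ^ σ
  Disagreement⇒⊮PEMᵥ^ σ α⊮σ (_ , _ , _ , _ , _ , α⊮p) (inj₁ (inj₁ α⊩p)) = α⊮p α⊩p
  Disagreement⇒⊮PEMᵥ^ σ α⊮σ _ (inj₁ (inj₂ α⊩σ)) = α⊮σ α⊩σ
  Disagreement⇒⊮PEMᵥ^ σ α⊮σ (β , _ , α≤β , β⊮σ , β⊩p , _) (inj₂ α⊩¬p) with α⊩¬p β α≤β (inj₁ β⊩p)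
  ... | inj₂ β⊩σ = β⊮σ β⊩σ

  isolating : ∀ n σ {α} → ¬ α ⊩ᴹ σ → Height≤ σ n α → ∃ λ ρ → PEMStar ρ × Isolates α (ρ ^ σ)
  isolating n σ {α} α⊮σ height with em {Disagreement σ α}
  ... | no agreement = ⊥' , (zero , refl) , ¬Disagreement⇒Isolates σ α⊮σ agreement
  isolating zero σ α⊮σ () | yes _
  isolating (suc n) σ α⊮σ height | yes disagreement@(_ , p , _)
    with isolating n (PEMᵥ p ^ σ) α⊮σ′ (Height≤-PEMᵥ^ σ p n α⊮σ′ height)
    where
    α⊮σ′ : ¬ _ ⊩ᴹ PEMᵥ p ^ σ
    α⊮σ′ = Disagreement⇒⊮PEMᵥ^ σ α⊮σ disagreement
  ... | ρ , ρ∈PEM* , iso =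
    ρ ^ PEMᵥ p , PEMStar-^ ρ∈PEM* (var p , refl) , Isolates-resp-≋ (≋-sym (^-assoc (PEMᵥ p) σ ρ)) iso

mainTheorem2 : ExcludedMiddle 0ℓ → (M : KripkeModel) → FiniteDepth M →
    (α : KripkeModel.K M) →
    Σ Formula (λ ρ → PEMStar ρ × ((A : Formula) → (_⊩_ M α (A ^ ρ)) ⇔ (_⊨_ M α A)))
mainTheorem2 em M (n , depth≤n) α =
  let open Classical em M
      ρ , ρ∈PEM* , isoρ^⊥ = isolating n ⊥' (λ ()) (depth≤⇒Height≤-⊥ n α λ xs → depth≤n (α ∷ xs))
      isoρ = Isolates-resp-≋ (Forcing.^⊥≋ M ρ) isoρ^⊥
  in ρ , ρ∈PEM* , λ A → ⊩^⇔⊨ isoρ A (KripkeModel.≤-refl M) (Isolates.unforced isoρ)
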